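{- Let $\mathcal{T}$ be a DL-Lite TBox, $\mathcal{K}=\langle\mathcal{T},\mathcal{A}\rangle$ an inconsistent knowledge base, and $\alpha$ an atomic Boolean instance query with $\mathcal{K}\not\models_{\mathrm{brave}}\alpha$. If $\mathcal{H}$ is a $\subseteq$-minimal or a $\leq$-minimal brave-hypothesis for $\langle\mathcal{K},\alpha\rangle$, then $|\mathcal{H}|=1$.
   Context: DL-Lite means DL-Lite$_{\mathcal{R}}$ (concept inclusions $B\sqsubseteq C$ and role inclusions $Q\sqsubseteq S$ with $B::=A\mid\exists Q$, $C::=B\mid\neg B$, $Q::=R\mid R^-$, $S::=Q\mid\neg Q$) or DL-Lite$_{\mathrm{core}}$ (no role inclusions). An ABox is a finite set of assertions $A(a)$, $r(a,b)$. A repair of $\langle\mathcal{T},\mathcal{A}\rangle$ is a subset-maximal $\mathcal{T}$-consistent subset of $\mathcal{A}$. $\mathcal{K}\models_{\mathrm{brave}}q$ iff some repair $\mathcal{R}$ has $\langle\mathcal{T},\mathcal{R}\rangle\models q$. An atomic Boolean instance query is $A(a)$ with $A$ a concept name and $a$ an individual name. A brave-hypothesis for $\langle\mathcal{K},\alpha\rangle$ is an ABox $\mathcal{H}$ with $\langle\mathcal{T},\mathcal{A}\cup\mathcal{H}\rangle\models_{\mathrm{brave}}\alpha$; it is $\subseteq$-minimal if no brave-hypothesis is a proper subset of it, and $\leq$-minimal if no brave-hypothesis has smaller cardinality. -}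

module Defs where

open import Data.Nat using (ℕ; _<_) renaming (_≟_ to _≟ℕ_)
open import Data.Product using (Σ; _×_; _,_)
open import Data.List using (List; _++_; length; deduplicate; [_])
open import Data.List.Membership.Propositional using (_∈_)
open import Data.List.Relation.Binary.Subset.Propositional using (_⊆_)
open import Relation.Nullary using (¬_; Dec; yes; no)
open import Relation.Binary.PropositionalEquality using (_≡_; refl)

ConceptName RoleName IndName : Set
ConceptName = ℕ
RoleName = ℕ
IndName = ℕ

data Role : Set where
  role : RoleName → Role
  inv  : RoleName → Role

data Basic : Set where
  atom : ConceptName → Basic
  ex   : Role → Basic

data GConcept : Set where
  posC : Basic → GConcept
  negC : Basic → GConcept

data GRole : Set where
  posR : Role → GRole
  negR : Role → GRole

-- DL-Lite_R axioms: B ⊑ C and Q ⊑ S  (DL-Lite_core = no role inclusions)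
data Axiom : Set where
  _⊑C_ : Basic → GConcept → Axiom
  _⊑R_ : Role → GRole → Axiom

TBox : Set
TBox = List Axiom

data Assertion : Set where
  cAs : ConceptName → IndName → Assertion
  rAs : RoleName → IndName → IndName → Assertion

ABox : Set
ABox = List Assertion

_≟A_ : (x y : Assertion) → Dec (x ≡ y)
cAs A a ≟A cAs B b with A ≟ℕ B | a ≟ℕ b
... | yes refl | yes refl = yes refl
... | no p | _ = no λ { refl → p refl }
... | yes _ | no q = no λ { refl → q refl }
cAs _ _ ≟A rAs _ _ _ = no λ ()
rAs _ _ _ ≟A cAs _ _ = no λ ()
rAs r a b ≟A rAs s c d with r ≟ℕ s | a ≟ℕ c | b ≟ℕ d
... | yes refl | yes refl | yes refl = yes refl
... | no p | _ | _ = no λ { refl → p refl }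
... | yes _ | no q | _ = no λ { refl → q refl }
... | yes _ | yes _ | no u = no λ { refl → u refl }

-- Cardinality of an ABox (a finite set of assertions, represented by a list):
-- the number of distinct assertions in it.
card : ABox → ℕ
card H = length (deduplicate _≟A_ H)

_⊂_ : ABox → ABox → Set
X ⊂ Y = X ⊆ Y × ¬ (Y ⊆ X)

record Interp : Set₁ where
  field
    Δ    : Set
    conc : ConceptName → Δ → Set
    rol  : RoleName → Δ → Δ → Set
    ind  : IndName → Δ

module _ (I : Interp) where
  open Interp I

  ⟦_⟧Q : Role → Δ → Δ → Set
  ⟦ role r ⟧Q x y = rol r x y
  ⟦ inv r ⟧Q x y = rol r y x

  ⟦_⟧B : Basic → Δ → Set
  ⟦ atom A ⟧B x = conc A x
  ⟦ ex Q ⟧B x = Σ Δ (λ y → ⟦ Q ⟧Q x y)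

  ⟦_⟧C : GConcept → Δ → Set
  ⟦ posC B ⟧C x = ⟦ B ⟧B x
  ⟦ negC B ⟧C x = ¬ ⟦ B ⟧B x

  ⟦_⟧S : GRole → Δ → Δ → Set
  ⟦ posR Q ⟧S x y = ⟦ Q ⟧Q x y
  ⟦ negR Q ⟧S x y = ¬ ⟦ Q ⟧Q x y

  satAx : Axiom → Set
  satAx (B ⊑C C) = ∀ x → ⟦ B ⟧B x → ⟦ C ⟧C x
  satAx (Q ⊑R S) = ∀ x y → ⟦ Q ⟧Q x y → ⟦ S ⟧S x y

  satAs : Assertion → Set
  satAs (cAs A a) = conc A (ind a)
  satAs (rAs r a b) = rol r (ind a) (ind b)

Model : TBox → ABox → Interp → Set
Model T A I = (∀ ax → ax ∈ T → satAx I ax) × (∀ β → β ∈ A → satAs I β)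

Consistent : TBox → ABox → Set₁
Consistent T A = Σ Interp (Model T A)

record AIQ : Set where
  constructor _⟨_⟩
  field
    qConcept : ConceptName
    qInd     : IndName

Entails : TBox → ABox → AIQ → Set₁
Entails T A (C ⟨ a ⟩) = ∀ I → Model T A I → satAs I (cAs C a)

Repair : TBox → ABox → ABox → Set₁
Repair T A R =
  R ⊆ A × Consistent T R ×
  (∀ R' → R' ⊆ A → Consistent T R' → ¬ (R ⊂ R'))

BraveEntails : TBox → ABox → AIQ → Set₁
BraveEntails T A q = Σ ABox (λ R → Repair T A R × Entails T R q)

BraveHyp : TBox → ABox → AIQ → ABox → Set₁
BraveHyp T A q H = BraveEntails T (A ++ H) q

SubMinimalHyp : TBox → ABox → AIQ → ABox → Set₁
SubMinimalHyp T A q H =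
  BraveHyp T A q H × (∀ H' → H' ⊂ H → ¬ BraveHyp T A q H')

CardMinimalHyp : TBox → ABox → AIQ → ABox → Set₁
CardMinimalHyp T A q H =
  BraveHyp T A q H × (∀ H' → card H' < card H → ¬ BraveHyp T A q H')

{-# OPTIONS --safe #-}
module Submission where

-- In DL-Lite every atomic query C(a) entailed by a consistent ABox R is
-- already entailed by a single assertion β ∈ R: given any model J of R,
-- replace the individual a by a fresh element ⋆ that satisfies only those
-- basic concepts derivable for a from a single assertion via positive
-- inclusions (role edges at ⋆ are restricted accordingly). Negative
-- inclusions are inherited from J, so this is again a model, and C(a)
-- holding in it means that C is derivable for a.
--
-- Now let R be a repair of A ∪ H entailing α, and β ∈ R such a cause. As {β}
-- is consistent it extends to a repair of any ABox containing β, and that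
-- repair bravely entails α. So β ∉ A (as K ⊭ α bravely), i.e. β ∈ H and {β}
-- is itself a brave-hypothesis, whence H = {β} by either kind of minimality.
--
-- Consistency is not decidable here, so repairs exist only in the
-- double-negation sense; this suffices because card H ≡ 1 is decidable.

open import Defs
open import Level using (_⊔_)
open import Data.Empty using (⊥-elim)
open import Data.Unit using (⊤; tt)
open import Data.Nat using (suc; _<_; s≤s; z≤n; _≟_)
open import Data.Nat.Properties using (≤-antisym; ≮⇒≥)
open import Data.Product using (∃-syntax; _×_; _,_; proj₁; proj₂; map₂; swap)
open import Data.Sum using (_⊎_; inj₁; inj₂; [_,_]′)
open import Data.List using (List; []; _∷_; [_]; length; deduplicate)
open import Data.List.Properties using (filter-none)
open import Data.List.Membership.Propositional using (_∈_)
open import Data.List.Membership.Propositional.Properties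
  using (∈-++⁻; ∈-++⁺ʳ; ∈-deduplicate⁻)
open import Data.List.Relation.Unary.Any using (here; there)
open import Data.List.Relation.Unary.All using (tabulate)
open import Data.List.Relation.Binary.Subset.Propositional using (_⊆_)
open import Data.List.Relation.Binary.Subset.Propositional.Properties
  using (⊆-refl; ⊆-trans; xs⊆x∷xs; ∷⁺ʳ; ∈-∷⁺ʳ)
open import Data.List.Relation.Binary.Subset.DecPropositional _≟A_ using (_⊆?_)
open import Relation.Binary.Construct.Closure.ReflexiveTransitive
  using (Star; ε; _◅_; _◅◅_)
open import Relation.Binary.PropositionalEquality
  using (_≡_; refl; sym; trans; cong; subst; subst₂)
open import Relation.Nullary using (¬_; Dec; yes; no; ¬?)
open import Relation.Nullary.Negation using (contradiction; ¬¬-map)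
open import Relation.Nullary.Decidable using (decidable-stable; ¬¬-excluded-middle)
open import Function using (id; _∘_)
open import Function.Bundles using (_⇔_; mk⇔; Equivalence)

open Equivalence using (to; from)

module MaximalSubsets {x p} {X : Set x}
  (P : List X → Set p) (P-⊆ : ∀ {Y Z} → Y ⊆ Z → P Z → P Y) where

  Saturated : List X → List X → Set (x ⊔ p)
  Saturated L R = ∀ {y} → y ∈ L → y ∈ R ⊎ ¬ P (y ∷ R)

  SaturatedExtension : List X → List X → List X → Set (x ⊔ p)
  SaturatedExtension A S L = ∃[ R ] S ⊆ R × R ⊆ A × P R × Saturated L R

  saturating-extension : ∀ {A S} L → L ⊆ A → S ⊆ A → P S → ¬ ¬ SaturatedExtension A S L
  saturating-extension []      _    S⊆A PS = contradiction (_ , ⊆-refl , S⊆A , PS , λ ())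
  saturating-extension {A} {S} (y ∷ L) y∷L⊆A S⊆A PS k =
    ¬¬-excluded-middle λ P[y∷S]? → extend P[y∷S]? k
    where
    L⊆A : L ⊆ A
    L⊆A = ⊆-trans (xs⊆x∷xs L y) y∷L⊆A

    take-y : SaturatedExtension A (y ∷ S) L → SaturatedExtension A S (y ∷ L)
    take-y (R , y∷S⊆R , R⊆A , PR , sat) =
      R , ⊆-trans (xs⊆x∷xs S y) y∷S⊆R , R⊆A , PR ,
      λ { (here refl) → inj₁ (y∷S⊆R (here refl)) ; (there y∈L) → sat y∈L }

    skip-y : ¬ P (y ∷ S) → SaturatedExtension A S L → SaturatedExtension A S (y ∷ L)
    skip-y ¬P[y∷S] (R , S⊆R , R⊆A , PR , sat) =
      R , S⊆R , R⊆A , PR ,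
      λ { (here refl) → inj₂ (¬P[y∷S] ∘ P-⊆ (∷⁺ʳ y S⊆R)) ; (there y∈L) → sat y∈L }

    extend : Dec (P (y ∷ S)) → ¬ ¬ SaturatedExtension A S (y ∷ L)
    extend (yes P[y∷S]) =
      ¬¬-map take-y (saturating-extension L L⊆A (∈-∷⁺ʳ (y∷L⊆A (here refl)) S⊆A) P[y∷S])
    extend (no ¬P[y∷S]) = ¬¬-map (skip-y ¬P[y∷S]) (saturating-extension L L⊆A S⊆A PS)

  Maximal : List X → List X → Set (x ⊔ p)
  Maximal A R = ∀ R' → R' ⊆ A → P R' → ¬ (R ⊆ R' × ¬ (R' ⊆ R))

  saturated⇒maximal : ∀ {A R} → Saturated A R → Maximal A R
  saturated⇒maximal sat R' R'⊆A PR' (R⊆R' , R'⊈R) = R'⊈R λ y∈R' →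
    [ id , contradiction (P-⊆ (∈-∷⁺ʳ y∈R' R⊆R') PR') ]′ (sat (R'⊆A y∈R'))

  maximal-extension : ∀ {A S} → S ⊆ A → P S →
    ¬ ¬ (∃[ R ] S ⊆ R × R ⊆ A × P R × Maximal A R)
  maximal-extension S⊆A PS k = saturating-extension _ ⊆-refl S⊆A PS
    λ (R , S⊆R , R⊆A , PR , sat) → k (R , S⊆R , R⊆A , PR , saturated⇒maximal sat)

consistent-⊆ : ∀ {T X Y} → X ⊆ Y → Consistent T Y → Consistent T X
consistent-⊆ X⊆Y (I , I⊨T , I⊨Y) = I , I⊨T , λ β β∈X → I⊨Y β (X⊆Y β∈X)

repair-⊇ : ∀ {T A S} → S ⊆ A → Consistent T S → ¬ ¬ (∃[ R ] S ⊆ R × Repair T A R)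
repair-⊇ {T} = MaximalSubsets.maximal-extension (Consistent T) consistent-⊆

inverse : Role → Role
inverse (role r) = inv r
inverse (inv r)  = role r

⟦inverse⟧ : ∀ I Q {x y} → ⟦_⟧Q I (inverse Q) x y ⇔ ⟦_⟧Q I Q y x
⟦inverse⟧ I (role r) = mk⇔ id id
⟦inverse⟧ I (inv r)  = mk⇔ id id

TBoxModel : TBox → Interp → Set
TBoxModel T I = ∀ ax → ax ∈ T → satAx I ax

infix 4 _⊢_⊑₁_ _⊢_⊑*_

data _⊢_⊑₁_ (T : TBox) : Basic → Basic → Set where
  concept : ∀ {B B'} → (B ⊑C posC B') ∈ T → T ⊢ B ⊑₁ B'
  domain  : ∀ {Q Q'} → (Q ⊑R posR Q') ∈ T → T ⊢ ex Q ⊑₁ ex Q'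
  range   : ∀ {Q Q'} → (Q ⊑R posR Q') ∈ T → T ⊢ ex (inverse Q) ⊑₁ ex (inverse Q')

_⊢_⊑*_ : TBox → Basic → Basic → Set
T ⊢ B ⊑* B' = Star (T ⊢_⊑₁_) B B'

⊑₁-sound : ∀ {T I B B' x} → TBoxModel T I → T ⊢ B ⊑₁ B' → ⟦_⟧B I B x → ⟦_⟧B I B' x
⊑₁-sound {x = x} I⊨T (concept ax) b       = I⊨T _ ax x b
⊑₁-sound {x = x} I⊨T (domain ax)  (y , q) = y , I⊨T _ ax x y q
⊑₁-sound {I = I} {x = x} I⊨T (range {Q} {Q'} ax) (y , q) =
  y , from (⟦inverse⟧ I Q') (I⊨T _ ax y x (to (⟦inverse⟧ I Q) q))

⊑*-sound : ∀ {T I B B' x} → TBoxModel T I → T ⊢ B ⊑* B' → ⟦_⟧B I B x → ⟦_⟧B I B' x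
⊑*-sound I⊨T ε       b = b
⊑*-sound I⊨T (s ◅ d) b = ⊑*-sound I⊨T d (⊑₁-sound I⊨T s b)

data Asserts (a : IndName) : Assertion → Basic → Set where
  concept : ∀ A → Asserts a (cAs A a) (atom A)
  domain  : ∀ r b → Asserts a (rAs r a b) (ex (role r))
  range   : ∀ r b → Asserts a (rAs r b a) (ex (inv r))

asserts-sound : ∀ {I a β B} → Asserts a β B → satAs I β → ⟦_⟧B I B (Interp.ind I a)
asserts-sound         (concept A) c = c
asserts-sound {I = I} (domain r b) e = Interp.ind I b , e
asserts-sound {I = I} (range r b)  e = Interp.ind I b , e

Supports : TBox → IndName → Assertion → Basic → Set
Supports T a β B = ∃[ B₀ ] Asserts a β B₀ × T ⊢ B₀ ⊑* B

Derivable : TBox → ABox → IndName → Basic → Set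
Derivable T R a B = ∃[ β ] β ∈ R × Supports T a β B

supports-sound : ∀ {T I a β B} → TBoxModel T I → Supports T a β B → satAs I β →
  ⟦_⟧B I B (Interp.ind I a)
supports-sound I⊨T (_ , asserts , d) β-holds = ⊑*-sound I⊨T d (asserts-sound asserts β-holds)

supports⇒entails : ∀ {T X a β C} → Supports T a β (atom C) → β ∈ X → Entails T X (C ⟨ a ⟩)
supports⇒entails sup β∈X I (I⊨T , I⊨X) = supports-sound I⊨T sup (I⊨X _ β∈X)

derivable-step : ∀ {T R a B B'} → Derivable T R a B → T ⊢ B ⊑₁ B' → Derivable T R a B'
derivable-step (β , β∈R , B₀ , asserts , d) s = β , β∈R , B₀ , asserts , d ◅◅ s ◅ ε

module StarModel {T : TBox} {R : ABox} (a : IndName) {J : Interp} (J⊨ : Model T R J) where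
  open Interp J

  data Elem : Set where
    ⋆   : Elem
    ⌜_⌝ : Δ → Elem

  ∣_∣ : Elem → Δ
  ∣ ⋆ ∣     = ind a
  ∣ ⌜ x ⌝ ∣ = x

  Guard : Elem → Basic → Set
  Guard ⋆     B = Derivable T R a B
  Guard ⌜ _ ⌝ _ = ⊤

  guard-step : ∀ u {B B'} → T ⊢ B ⊑₁ B' → Guard u B → Guard u B'
  guard-step ⋆     s d = derivable-step d s
  guard-step ⌜ _ ⌝ _ _ = tt

  individual : IndName → Elem
  individual b with b ≟ a
  ... | yes _ = ⋆
  ... | no _  = ⌜ ind b ⌝

  ∣individual∣ : ∀ b → ∣ individual b ∣ ≡ ind b
  ∣individual∣ b with b ≟ a
  ... | yes refl = refl
  ... | no _     = refl

  individual-a : individual a ≡ ⋆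
  individual-a with a ≟ a
  ... | yes _   = refl
  ... | no a≢a = contradiction refl a≢a

  guard-individual : ∀ {β b B} → β ∈ R → Asserts b β B → Guard (individual b) B
  guard-individual {b = b} β∈R asserts with b ≟ a
  ... | yes refl = _ , β∈R , _ , asserts , ε
  ... | no _     = tt

  M : Interp
  M = record
    { Δ    = Elem
    ; conc = λ A u → conc A ∣ u ∣ × Guard u (atom A)
    ; rol  = λ r u v → rol r ∣ u ∣ ∣ v ∣ × Guard u (ex (role r)) × Guard v (ex (inv r))
    ; ind  = individual
    }

  role-⇔ : ∀ Q u v →
    ⟦_⟧Q M Q u v ⇔ (⟦_⟧Q J Q ∣ u ∣ ∣ v ∣ × Guard u (ex Q) × Guard v (ex (inverse Q)))
  role-⇔ (role r) u v = mk⇔ id id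
  role-⇔ (inv r)  u v = mk⇔ (map₂ swap) (map₂ swap)

  basic-⇔ : ∀ B u → ⟦_⟧B M B u ⇔ (⟦_⟧B J B ∣ u ∣ × Guard u B)
  basic-⇔ (atom A) u = mk⇔ id id
  basic-⇔ (ex Q)   u = mk⇔
    (λ (v , q) → let (j , g , _) = to (role-⇔ Q u v) q in (∣ v ∣ , j) , g)
    (λ ((y , j) , g) → ⌜ y ⌝ , from (role-⇔ Q u ⌜ y ⌝) (j , g , tt))

  tbox-model : TBoxModel T M
  tbox-model (B ⊑C posC B') ax u b =
    let (j , g) = to (basic-⇔ B u) b
    in from (basic-⇔ B' u) (proj₁ J⊨ _ ax ∣ u ∣ j , guard-step u (concept ax) g)
  tbox-model (B ⊑C negC B') ax u b b' =
    proj₁ J⊨ _ ax ∣ u ∣ (proj₁ (to (basic-⇔ B u) b)) (proj₁ (to (basic-⇔ B' u) b'))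
  tbox-model (Q ⊑R posR Q') ax u v q =
    let (j , g , g⁻) = to (role-⇔ Q u v) q
    in from (role-⇔ Q' u v)
         (proj₁ J⊨ _ ax ∣ u ∣ ∣ v ∣ j , guard-step u (domain ax) g , guard-step v (range ax) g⁻)
  tbox-model (Q ⊑R negR Q') ax u v q q' =
    proj₁ J⊨ _ ax ∣ u ∣ ∣ v ∣ (proj₁ (to (role-⇔ Q u v) q)) (proj₁ (to (role-⇔ Q' u v) q'))

  abox-model : ∀ β → β ∈ R → satAs M β
  abox-model (cAs A b) β∈R =
    subst (conc A) (sym (∣individual∣ b)) (proj₂ J⊨ _ β∈R) ,
    guard-individual β∈R (concept A)
  abox-model (rAs r b c) β∈R =
    subst₂ (rol r) (sym (∣individual∣ b)) (sym (∣individual∣ c)) (proj₂ J⊨ _ β∈R) ,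
    guard-individual β∈R (domain r c) , guard-individual β∈R (range r b)

  query-derivable : ∀ {C} → satAs M (cAs C a) → Derivable T R a (atom C)
  query-derivable {C} (_ , g) = subst (λ u → Guard u (atom C)) individual-a g

entailed⇒derivable : ∀ {T R C a} → Consistent T R → Entails T R (C ⟨ a ⟩) →
  Derivable T R a (atom C)
entailed⇒derivable {a = a} (J , J⊨) R⊨Ca = query-derivable (R⊨Ca M (tbox-model , abox-model))
  where open StarModel a J⊨

singleton-brave : ∀ {T X a β C} → β ∈ X → Consistent T [ β ] → Supports T a β (atom C) →
  ¬ ¬ BraveEntails T X (C ⟨ a ⟩)
singleton-brave β∈X β-consistent sup k = repair-⊇ (λ { (here refl) → β∈X }) β-consistent
  λ (R , β⊆R , repair) → k (R , repair , supports⇒entails sup (β⊆R (here refl)))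

card-pos : ∀ {β : Assertion} {H} → β ∈ H → 0 < card H
card-pos {H = _ ∷ _} _ = s≤s z≤n

-- deduplicate (x ∷ H) filters every copy of x out of the tail, which is
-- all of it when every element equals β.
card-⊆-singleton : ∀ {β H} → β ∈ H → H ⊆ [ β ] → card H ≡ 1
card-⊆-singleton {β} {x ∷ H} _ H⊆[β] =
  cong (suc ∘ length) (filter-none (¬? ∘ (x ≟A_)) (tabulate λ y∈ x≢y →
    x≢y (trans (≡β (here refl)) (sym (≡β (there (∈-deduplicate⁻ _≟A_ H y∈)))))))
  where
  ≡β : ∀ {y} → y ∈ x ∷ H → y ≡ β
  ≡β y∈ with H⊆[β] y∈
  ... | here y≡β = y≡β

singleton-hyp-minimal : ∀ {T A q β H} → β ∈ H → BraveHyp T A q [ β ] →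
  SubMinimalHyp T A q H ⊎ CardMinimalHyp T A q H → card H ≡ 1
singleton-hyp-minimal {β = β} {H} β∈H [β]-hyp (inj₁ (_ , ⊂-minimal)) with H ⊆? [ β ]
... | yes H⊆[β] = card-⊆-singleton β∈H H⊆[β]
... | no  H⊈[β] = ⊥-elim (⊂-minimal [ β ] ((λ { (here refl) → β∈H }) , H⊈[β]) [β]-hyp)
singleton-hyp-minimal β∈H [β]-hyp (inj₂ (_ , <-minimal)) =
  ≤-antisym (≮⇒≥ λ card<1 → <-minimal _ card<1 [β]-hyp) (card-pos β∈H)

mainTheorem10 : (T : TBox) (A : ABox) (q : AIQ) →
    ¬ Consistent T A →
    ¬ BraveEntails T A q →
    (H : ABox) →
    SubMinimalHyp T A q H ⊎ CardMinimalHyp T A q H →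
    card H ≡ 1
mainTheorem10 T A (C ⟨ a ⟩) _ ¬brave H minimal =
  decidable-stable (card H ≟ 1) λ card≢1 →
    let (R , (R⊆A++H , R-consistent , _) , R⊨α) = [ proj₁ , proj₁ ]′ minimal
        (β , β∈R , β-supports-α) = entailed⇒derivable R-consistent R⊨α
        β-consistent = consistent-⊆ (λ { (here refl) → β∈R }) R-consistent
    in [ (λ β∈A → singleton-brave β∈A β-consistent β-supports-α ¬brave)
       , (λ β∈H → singleton-brave (∈-++⁺ʳ A (here refl)) β-consistent β-supports-α
                    λ [β]-hyp → card≢1 (singleton-hyp-minimal β∈H [β]-hyp minimal))
       ]′ (∈-++⁻ A (R⊆A++H β∈R))
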